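{- Let $a$ and $b$ be positive, relatively prime integers, $S=\{a,b\}$, let $c$ be a Frobenius value with respect to $S$, and let $c=\alpha a+\beta b$ be its $a$-normal form. Then the length of $c$ with respect to $S$ is attained either at the $a$-normal form or at the $b$-normal form of $c$, and \[ \ell(c)=\min\{|\alpha|+|\beta|,\ a+b-(|\alpha|+|\beta|)\}. \]
   Context: The length $\ell(c)$ of an integer $c$ with respect to $S=\{a,b\}$ is the least $k$ such that $c$ is a sum of $k$ elements of $\{a,b,-a,-b\}$; equivalently $\ell(c)=\min\{|x|+|y| : x,y\in\mathbb{Z},\ c=xa+yb\}$. An integer $c$ is a Frobenius value with respect to $S$ if it is neither of the form $xa+yb$ with $x,y\ge0$ nor of the form $xa+yb$ with $x,y\le 0$ ($x,y$ integers). The $a$-normal form of $c$ is the unique representation $c=\alpha a+\beta b$ with integers $\alpha,\beta$ and $0\le\alpha<b$; the $b$-normal form is the unique representation $c=\alpha a+\beta b$ with integers $\alpha,\beta$ and $0\le\beta<a$. -}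

module Defs where

open import Data.Nat using (ℕ)
open import Data.Integer using (ℤ; +_; _+_; _*_; _≤_; _<_; ∣_∣)
import Data.Nat as N
open import Data.Product using (Σ; ∃; _×_; _,_)
open import Relation.Binary.PropositionalEquality using (_≡_)
open import Relation.Nullary using (¬_)

-- c is a sum of k elements of {a,b,-a,-b}, i.e. c = x a + y b with |x|+|y| = k
RepLen : ℤ → ℤ → ℤ → ℕ → Set
RepLen a b c k = Σ ℤ λ x → Σ ℤ λ y → (c ≡ x * a + y * b) × (∣ x ∣ N.+ ∣ y ∣ ≡ k)

IsLength : ℤ → ℤ → ℤ → ℕ → Set
IsLength a b c k = RepLen a b c k × (∀ m → RepLen a b c m → k N.≤ m)

IsFrobeniusValue : ℤ → ℤ → ℤ → Set
IsFrobeniusValue a b c =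
  (¬ (Σ ℤ λ x → Σ ℤ λ y → (+ 0 ≤ x) × (+ 0 ≤ y) × (c ≡ x * a + y * b))) ×
  (¬ (Σ ℤ λ x → Σ ℤ λ y → (x ≤ + 0) × (y ≤ + 0) × (c ≡ x * a + y * b)))

IsANormalForm : ℤ → ℤ → ℤ → ℤ → ℤ → Set
IsANormalForm a b c α β = (c ≡ α * a + β * b) × (+ 0 ≤ α) × (α < b)

IsBNormalForm : ℤ → ℤ → ℤ → ℤ → ℤ → Set
IsBNormalForm a b c α β = (c ≡ α * a + β * b) × (+ 0 ≤ β) × (β < a)

module Submission where

-- Since gcd(a, b) = 1, the representations of c are exactly (α + t b, β − t a), t ∈ ℤ.
-- As |x| + |y| ≥ x − y and ≥ y − x, the representation with parameter t has length
-- at least (α − β) + t (a + b) when t ≥ 0 and (a + b) − (α − β) + (−1 − t)(a + b) when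
-- t < 0; these bounds are attained at t = 0 and t = −1, i.e. at the a-normal form and
-- at (α − b, β + a).  Being a Frobenius value forces α > 0 > β and β + a > 0, which
-- makes α − β = |α| + |β| and shows that (α − b, β + a) is the b-normal form.

open import Defs
open import Data.Nat using (ℕ)
open import Data.Integer using (ℤ; +_; _<_; ∣_∣; _⊓_; _-_; _+_)
open import Data.Integer.GCD using (gcd)
open import Data.Product using (_×_)
open import Data.Sum using (_⊎_)
open import Relation.Binary.PropositionalEquality using (_≡_)
import Data.Nat as N

open import Data.Integer using (_*_; -_; _≤_; -[1+_]; +[1+_]; 0ℤ; +≤+; -≤+; NonZero)
open import Data.Integer.Base using (>-nonZero)
open import Data.Integer.Properties
  using ( ≤-refl; ≤-trans; ≤-antisym; ≤-<-trans; <⇒≤; ≤⇒≯; ≰⇒>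
        ; +-monoʳ-≤; +-mono-≤; +-mono-<; +-monoˡ-<; +-identityˡ; +-identityʳ; +-inverseʳ; +-injective
        ; pos-+; pos-*; *-cancelʳ-≡; 0≤i⇒+∣i∣≡i; ∣-i∣≡∣i∣; neg-mono-≤; ∣i-j∣≤∣i∣+∣j∣
        ; ⊓-glb; i⊓j≤i; i⊓j≤j; module ≤-Reasoning )
open import Data.Integer.Coprimality using (Coprime; coprime-divisor)
import Data.Integer.Coprimality as Coprime
open import Data.Integer.Divisibility.Signed using (_∣_; divides; ∣⇒∣ᵤ; ∣ᵤ⇒∣)
open import Data.Integer.Tactic.RingSolver using (solve-∀)
import Data.Nat.Properties as ℕ
open import Data.Nat.Coprimality using (gcd≡1⇒coprime)
open import Data.Product using (∃-syntax; _,_; proj₁; proj₂)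
open import Data.Sum using (inj₁; inj₂)
import Data.Sum as Sum
open import Data.Empty using (⊥-elim)
open import Relation.Binary.PropositionalEquality
  using (refl; sym; trans; cong; cong₂; subst; subst₂; module ≡-Reasoning)

i≤+∣i∣ : ∀ i → i ≤ + ∣ i ∣
i≤+∣i∣ (+ n)    = ≤-refl
i≤+∣i∣ -[1+ n ] = -≤+

i-j≤∣i∣+∣j∣ : ∀ i j → i - j ≤ + (∣ i ∣ N.+ ∣ j ∣)
i-j≤∣i∣+∣j∣ i j = ≤-trans (i≤+∣i∣ (i - j)) (+≤+ (∣i-j∣≤∣i∣+∣j∣ i j))

i≤i+j-nonNeg : ∀ i {j} → 0ℤ ≤ j → i ≤ i + j
i≤i+j-nonNeg i 0≤j = subst (_≤ i + _) (+-identityʳ i) (+-monoʳ-≤ i 0≤j)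

i<j⇒i-j<0 : ∀ {i j} → i < j → i - j < 0ℤ
i<j⇒i-j<0 {i} {j} i<j = subst (i - j <_) (+-inverseʳ j) (+-monoˡ-< (- j) i<j)

0≤+n*i : ∀ n {i} → 0ℤ ≤ i → 0ℤ ≤ + n * i
0≤+n*i n {+ m} _ = subst (0ℤ ≤_) (pos-* n m) (+≤+ N.z≤n)

+∣i∣+∣j∣≡i-j : ∀ {i j} → 0ℤ ≤ i → j ≤ 0ℤ → + (∣ i ∣ N.+ ∣ j ∣) ≡ i - j
+∣i∣+∣j∣≡i-j {i} {j} 0≤i j≤0 = begin
  + (∣ i ∣ N.+ ∣ j ∣)    ≡⟨ pos-+ ∣ i ∣ ∣ j ∣ ⟩
  + ∣ i ∣ + + ∣ j ∣      ≡⟨ cong₂ _+_ (0≤i⇒+∣i∣≡i 0≤i) (sym (cong +_ (∣-i∣≡∣i∣ j))) ⟩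
  i + + ∣ - j ∣          ≡⟨ cong (λ z → i + z) (0≤i⇒+∣i∣≡i (neg-mono-≤ j≤0)) ⟩
  i - j                  ∎
  where open ≡-Reasoning

≡⊓-of-attained : ∀ {k p q} → k ≤ p → k ≤ q → p ≤ k ⊎ q ≤ k → (k ≡ p ⊎ k ≡ q) × k ≡ p ⊓ q
≡⊓-of-attained {k} {p} {q} k≤p k≤q attained = attainedAt attained , ≤-antisym (⊓-glb k≤p k≤q) (⊓≤k attained)
  where
  attainedAt : p ≤ k ⊎ q ≤ k → k ≡ p ⊎ k ≡ q
  attainedAt (inj₁ p≤k) = inj₁ (≤-antisym k≤p p≤k)
  attainedAt (inj₂ q≤k) = inj₂ (≤-antisym k≤q q≤k)
  ⊓≤k : p ≤ k ⊎ q ≤ k → p ⊓ q ≤ k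
  ⊓≤k (inj₁ p≤k) = ≤-trans (i⊓j≤i p q) p≤k
  ⊓≤k (inj₂ q≤k) = ≤-trans (i⊓j≤j p q) q≤k

coprime-solutions : ∀ {a b} .{{_ : NonZero b}} → Coprime a b → ∀ {α β x y} →
  x * a + y * b ≡ α * a + β * b → ∃[ t ] (x ≡ α + t * b × y ≡ β - t * a)
coprime-solutions {a} {b} a⊥b {α} {β} {x} {y} eq = t , x≡α+tb , y≡β-ta
  where
  open ≡-Reasoning
  lhs-difference : ∀ x y α a b → a * (x - α) ≡ (x * a + y * b) - (α * a + y * b)
  lhs-difference = solve-∀
  rhs-difference : ∀ α β y a b → (α * a + β * b) - (α * a + y * b) ≡ (β - y) * b
  rhs-difference = solve-∀
  reassociate : ∀ t a b → t * a * b ≡ a * (t * b)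
  reassociate = solve-∀
  add-sub : ∀ x α → x ≡ α + (x - α)
  add-sub = solve-∀
  sub-sub : ∀ y β → y ≡ β - (β - y)
  sub-sub = solve-∀
  balance : a * (x - α) ≡ (β - y) * b
  balance = begin
    a * (x - α)                        ≡⟨ lhs-difference x y α a b ⟩
    (x * a + y * b) - (α * a + y * b)  ≡⟨ cong (_- (α * a + y * b)) eq ⟩
    (α * a + β * b) - (α * a + y * b)  ≡⟨ rhs-difference α β y a b ⟩
    (β - y) * b                        ∎
  b∣x-α : b ∣ x - α
  b∣x-α = ∣ᵤ⇒∣ (coprime-divisor b a (x - α) (Coprime.sym {a} {b} a⊥b) (∣⇒∣ᵤ (divides (β - y) balance)))
  t : ℤ
  t = _∣_.quotient b∣x-α
  x-α≡tb : x - α ≡ t * b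
  x-α≡tb = _∣_.equality b∣x-α
  ta≡β-y : t * a ≡ β - y
  ta≡β-y = *-cancelʳ-≡ (t * a) (β - y) b (begin
    t * a * b    ≡⟨ reassociate t a b ⟩
    a * (t * b)  ≡⟨ cong (a *_) (sym x-α≡tb) ⟩
    a * (x - α)  ≡⟨ balance ⟩
    (β - y) * b  ∎)
  x≡α+tb : x ≡ α + t * b
  x≡α+tb = begin
    x              ≡⟨ add-sub x α ⟩
    α + (x - α)    ≡⟨ cong (λ z → α + z) x-α≡tb ⟩
    α + t * b      ∎
  y≡β-ta : y ≡ β - t * a
  y≡β-ta = begin
    y              ≡⟨ sub-sub y β ⟩
    β - (β - y)    ≡⟨ cong (λ z → β - z) (sym ta≡β-y) ⟩
    β - t * a      ∎

shifted-length-lowerBound : ∀ {a b} → 0ℤ ≤ a + b → ∀ α β t →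
  let x = α + t * b ; y = β - t * a in
  α - β ≤ + (∣ x ∣ N.+ ∣ y ∣) ⊎ (a + b) - (α - β) ≤ + (∣ x ∣ N.+ ∣ y ∣)
shifted-length-lowerBound {a} {b} 0≤a+b α β (+ n) = inj₁ (begin
  α - β                        ≤⟨ i≤i+j-nonNeg (α - β) (0≤+n*i n 0≤a+b) ⟩
  (α - β) + + n * (a + b)      ≡⟨ shift-identity α β (+ n) a b ⟩
  x - y                        ≤⟨ i-j≤∣i∣+∣j∣ x y ⟩
  + (∣ x ∣ N.+ ∣ y ∣)          ∎)
  where
  open ≤-Reasoning
  x = α + + n * b
  y = β - + n * a
  shift-identity : ∀ α β n a b → (α - β) + n * (a + b) ≡ (α + n * b) - (β - n * a)
  shift-identity = solve-∀
shifted-length-lowerBound {a} {b} 0≤a+b α β -[1+ n ] = inj₂ (begin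
  (a + b) - (α - β)                 ≤⟨ i≤i+j-nonNeg ((a + b) - (α - β)) (0≤+n*i n 0≤a+b) ⟩
  ((a + b) - (α - β)) + + n * (a + b) ≡⟨ shift-identity α β (+ n) a b ⟩
  y - x                             ≤⟨ i-j≤∣i∣+∣j∣ y x ⟩
  + (∣ y ∣ N.+ ∣ x ∣)               ≡⟨ cong +_ (ℕ.+-comm ∣ y ∣ ∣ x ∣) ⟩
  + (∣ x ∣ N.+ ∣ y ∣)               ∎)
  where
  open ≤-Reasoning
  x = α + -[1+ n ] * b
  y = β - -[1+ n ] * a
  shift-identity : ∀ α β n a b →
    ((a + b) - (α - β)) + n * (a + b) ≡ (β - (- (+ 1 + n)) * a) - (α + (- (+ 1 + n)) * b)
  shift-identity = solve-∀

repLength-lowerBound : ∀ {a b c α β m} .{{_ : NonZero b}} → Coprime a b → 0ℤ ≤ a + b →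
  c ≡ α * a + β * b → RepLen a b c m → α - β ≤ + m ⊎ (a + b) - (α - β) ≤ + m
repLength-lowerBound {a} {b} {α = α} {β} a⊥b 0≤a+b c≡αa+βb (x , y , c≡xa+yb , refl) =
  lowerBound (coprime-solutions a⊥b {α} {β} {x} {y} (trans (sym c≡xa+yb) c≡αa+βb))
  where
  lowerBound : ∃[ t ] (x ≡ α + t * b × y ≡ β - t * a) →
    α - β ≤ + (∣ x ∣ N.+ ∣ y ∣) ⊎ (a + b) - (α - β) ≤ + (∣ x ∣ N.+ ∣ y ∣)
  lowerBound (t , refl , refl) = shifted-length-lowerBound 0≤a+b α β t

shift-in-range⇒≡0 : ∀ {a r t} → 0ℤ ≤ r → r < a → 0ℤ ≤ r - t * a → r - t * a < a → t ≡ 0ℤ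
shift-in-range⇒≡0 {t = + 0} _ _ _ _ = refl
shift-in-range⇒≡0 {a} {r} {+[1+ n ]} 0≤r r<a 0≤r-ta _ =
  ⊥-elim (≤⇒≯ 0≤r-ta (≤-<-trans r-ta≤r-a (i<j⇒i-j<0 r<a)))
  where
  shift-identity : ∀ r n a → (r - (+ 1 + n) * a) + n * a ≡ r - a
  shift-identity = solve-∀
  r-ta≤r-a : r - +[1+ n ] * a ≤ r - a
  r-ta≤r-a = subst (r - +[1+ n ] * a ≤_) (shift-identity r (+ n) a)
    (i≤i+j-nonNeg _ (0≤+n*i n (<⇒≤ (≤-<-trans 0≤r r<a))))
shift-in-range⇒≡0 {a} {r} { -[1+ n ]} 0≤r r<a _ r-ta<a = ⊥-elim (≤⇒≯ a≤r-ta r-ta<a)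
  where
  shift-identity : ∀ r n a → a + (r + n * a) ≡ r - (- (+ 1 + n)) * a
  shift-identity = solve-∀
  a≤r-ta : a ≤ r - -[1+ n ] * a
  a≤r-ta = subst (a ≤_) (shift-identity r (+ n) a)
    (i≤i+j-nonNeg a (+-mono-≤ 0≤r (0≤+n*i n (<⇒≤ (≤-<-trans 0≤r r<a)))))

bNormalForm-unique : ∀ {a b c α β α' β'} .{{_ : NonZero b}} → Coprime a b →
  IsBNormalForm a b c α β → IsBNormalForm a b c α' β' → α' ≡ α × β' ≡ β
bNormalForm-unique {a} {b} {α = α} {β} {α'} {β'} a⊥b (c≡αa+βb , 0≤β , β<a) (c≡α'a+β'b , 0≤β' , β'<a) =
  unshifted (coprime-solutions a⊥b {α} {β} {α'} {β'} (trans (sym c≡α'a+β'b) c≡αa+βb))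
  where
  unshifted : ∃[ t ] (α' ≡ α + t * b × β' ≡ β - t * a) → α' ≡ α × β' ≡ β
  unshifted (t , refl , refl) with shift-in-range⇒≡0 {t = t} 0≤β β<a 0≤β' β'<a
  ... | refl = +-identityʳ α , +-identityʳ β

module FrobeniusValue {a b c α β : ℤ} (frobenius : IsFrobeniusValue a b c) (aNF : IsANormalForm a b c α β) where

  private
    c≡αa+βb = proj₁ aNF
    0≤α = proj₁ (proj₂ aNF)
    α<b = proj₂ (proj₂ aNF)
    nonNegative = proj₁ frobenius
    nonPositive = proj₂ frobenius

    switch-identity : ∀ α β a b → α * a + β * b ≡ (α - b) * a + (β + a) * b
    switch-identity = solve-∀

  c≡[α-b]a+[β+a]b : c ≡ (α - b) * a + (β + a) * b
  c≡[α-b]a+[β+a]b = trans c≡αa+βb (switch-identity α β a b)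

  β<0 : β < 0ℤ
  β<0 = ≰⇒> λ 0≤β → nonNegative (α , β , 0≤α , 0≤β , c≡αa+βb)

  0<α : 0ℤ < α
  0<α = ≰⇒> λ α≤0 → nonPositive (α , β , α≤0 , <⇒≤ β<0 , c≡αa+βb)

  0<β+a : 0ℤ < β + a
  0<β+a = ≰⇒> λ β+a≤0 → nonPositive (α - b , β + a , <⇒≤ (i<j⇒i-j<0 α<b) , β+a≤0 , c≡[α-b]a+[β+a]b)

  bNormalForm : IsBNormalForm a b c (α - b) (β + a)
  bNormalForm = c≡[α-b]a+[β+a]b , <⇒≤ 0<β+a , subst (β + a <_) (+-identityˡ a) (+-monoˡ-< a β<0)

  length-aNormalForm : + (∣ α ∣ N.+ ∣ β ∣) ≡ α - β
  length-aNormalForm = +∣i∣+∣j∣≡i-j 0≤α (<⇒≤ β<0)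

  length-bNormalForm : + (∣ α - b ∣ N.+ ∣ β + a ∣) ≡ (a + b) - (α - β)
  length-bNormalForm = begin
    + (∣ α - b ∣ N.+ ∣ β + a ∣)  ≡⟨ cong +_ (ℕ.+-comm ∣ α - b ∣ ∣ β + a ∣) ⟩
    + (∣ β + a ∣ N.+ ∣ α - b ∣)  ≡⟨ +∣i∣+∣j∣≡i-j (<⇒≤ 0<β+a) (<⇒≤ (i<j⇒i-j<0 α<b)) ⟩
    (β + a) - (α - b)            ≡⟨ regroup α β a b ⟩
    (a + b) - (α - β)            ∎
    where
    open ≡-Reasoning
    regroup : ∀ α β a b → (β + a) - (α - b) ≡ (a + b) - (α - β)
    regroup = solve-∀

lemma3 : (a b : ℤ) → + 0 < a → + 0 < b → gcd a b ≡ + 1 →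
  (c : ℤ) → IsFrobeniusValue a b c →
  (α β : ℤ) → IsANormalForm a b c α β →
  (α' β' : ℤ) → IsBNormalForm a b c α' β' →
  (k : ℕ) → IsLength a b c k →
    ((k ≡ ∣ α ∣ N.+ ∣ β ∣) ⊎ (k ≡ ∣ α' ∣ N.+ ∣ β' ∣)) ×
    (+ k ≡ (+ (∣ α ∣ N.+ ∣ β ∣)) ⊓ ((a + b) - + (∣ α ∣ N.+ ∣ β ∣)))
lemma3 a b 0<a 0<b gcd≡1 c frobenius α β aNF α' β' bNF k (repLen , minimal) =
  conclude (≡⊓-of-attained (+≤+ (minimal L₁ (α , β , proj₁ aNF , refl)))
                           (+≤+ (minimal L₂ (α' , β' , proj₁ bNF , refl)))
                           lowerBound-attained)
  where
  instance
    b≢0 : NonZero b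
    b≢0 = >-nonZero 0<b
  open FrobeniusValue {a} {b} {c} {α} {β} frobenius aNF
  a⊥b : Coprime a b
  a⊥b = gcd≡1⇒coprime (+-injective gcd≡1)
  L₁ L₂ : ℕ
  L₁ = ∣ α ∣ N.+ ∣ β ∣
  L₂ = ∣ α' ∣ N.+ ∣ β' ∣
  +L₂≡a+b-[α-β] : + L₂ ≡ (a + b) - (α - β)
  +L₂≡a+b-[α-β] = trans (cong₂ (λ u v → + (∣ u ∣ N.+ ∣ v ∣)) (proj₁ bNF-unique) (proj₂ bNF-unique))
                         length-bNormalForm
    where
    bNF-unique : α' ≡ α - b × β' ≡ β + a
    bNF-unique = bNormalForm-unique {a} {b} {c} {α - b} {β + a} {α'} {β'} a⊥b bNormalForm bNF
  lowerBound-attained : + L₁ ≤ + k ⊎ + L₂ ≤ + k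
  lowerBound-attained = subst₂ (λ p q → p ≤ + k ⊎ q ≤ + k) (sym length-aNormalForm) (sym +L₂≡a+b-[α-β])
    (repLength-lowerBound {α = α} {β} a⊥b (<⇒≤ (+-mono-< 0<a 0<b)) (proj₁ aNF) repLen)
  conclude : (+ k ≡ + L₁ ⊎ + k ≡ + L₂) × + k ≡ + L₁ ⊓ + L₂ →
    (k ≡ L₁ ⊎ k ≡ L₂) × + k ≡ + L₁ ⊓ ((a + b) - + L₁)
  conclude (attained , +k≡min) =
    Sum.map +-injective +-injective attained ,
    trans +k≡min (cong (λ z → + L₁ ⊓ z) (trans +L₂≡a+b-[α-β] (cong (λ z → (a + b) - z) (sym length-aNormalForm))))
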